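{- Let $R$ be a ring and consider $x$ in the polynomial ring $R[x]$. If $x\in\operatorname{lpow}(x)$, then $x$ is irreducible in $R[x]$. If in addition one of the inclusions $\operatorname{lpow}(x)\subseteq\operatorname{pow}(x)$ or $\operatorname{pow}(x)\subseteq\operatorname{lpow}(x)$ holds, then $R$ is reduced.
   Context: All rings are nonzero, commutative and unital. $\operatorname{pow}(x)=\{x^n:n\ge1\}$; $\operatorname{lpow}(x)$ is the set of $f\in R[x]$ with $x\mid f$, $x-1\mid f-1$, and every divisor of $f$ either a unit or a multiple of $x$. Irreducible: nonzero, noninvertible, not a product of two nonunits. Reduced: no nonzero nilpotents. -}

module Defs where

open import Level using (_⊔_)
open import Algebra.Bundles using (CommutativeRing)
open import Data.Nat using (ℕ; zero; suc; _≥_)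
open import Data.List using (List; []; _∷_)
open import Data.Product using (Σ; ∃; _×_; _,_)
open import Data.Sum using (_⊎_)
open import Relation.Nullary using (¬_)

-- The polynomial ring R[x] over a commutative ring R, polynomials represented
-- as coefficient lists (constant term first), with equality meaning
-- coefficientwise equality in R (so trailing zeros do not matter).
module Poly {c ℓ} (R : CommutativeRing c ℓ) where
  open CommutativeRing R

  _^ᴿ_ : Carrier → ℕ → Carrier
  r ^ᴿ zero  = 1#
  r ^ᴿ suc n = r * r ^ᴿ n

  Reduced : Set (c ⊔ ℓ)
  Reduced = ∀ (r : Carrier) (n : ℕ) → r ^ᴿ n ≈ 0# → r ≈ 0#

  Pol : Set c
  Pol = List Carrier

  coeff : Pol → ℕ → Carrier
  coeff []      _       = 0#
  coeff (a ∷ p) zero    = a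
  coeff (a ∷ p) (suc n) = coeff p n

  infix 4 _≈ₚ_
  _≈ₚ_ : Pol → Pol → Set ℓ
  p ≈ₚ q = ∀ n → coeff p n ≈ coeff q n

  infixl 6 _+ₚ_
  _+ₚ_ : Pol → Pol → Pol
  []      +ₚ q       = q
  (a ∷ p) +ₚ []      = a ∷ p
  (a ∷ p) +ₚ (b ∷ q) = (a + b) ∷ (p +ₚ q)

  scale : Carrier → Pol → Pol
  scale a []      = []
  scale a (b ∷ q) = (a * b) ∷ scale a q

  infixl 7 _*ₚ_
  _*ₚ_ : Pol → Pol → Pol
  []      *ₚ q = []
  (a ∷ p) *ₚ q = scale a q +ₚ (0# ∷ (p *ₚ q))

  0ₚ : Pol
  0ₚ = []

  1ₚ : Pol
  1ₚ = 1# ∷ []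

  X : Pol
  X = 0# ∷ 1# ∷ []

  X-1 : Pol
  X-1 = (- 1#) ∷ 1# ∷ []

  _-1ₚ : Pol → Pol
  f -1ₚ = f +ₚ ((- 1#) ∷ [])

  _^ₚ_ : Pol → ℕ → Pol
  f ^ₚ zero  = 1ₚ
  f ^ₚ suc n = f *ₚ (f ^ₚ n)

  infix 4 _∣ₚ_
  _∣ₚ_ : Pol → Pol → Set (c ⊔ ℓ)
  f ∣ₚ g = ∃ λ h → g ≈ₚ f *ₚ h

  IsUnit : Pol → Set (c ⊔ ℓ)
  IsUnit u = ∃ λ v → u *ₚ v ≈ₚ 1ₚ

  Irreducible : Pol → Set (c ⊔ ℓ)
  Irreducible p = ¬ (p ≈ₚ 0ₚ) × ¬ IsUnit p ×
    ¬ (∃ λ a → ∃ λ b → p ≈ₚ a *ₚ b × ¬ IsUnit a × ¬ IsUnit b)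

  InPow : Pol → Set ℓ
  InPow f = ∃ λ n → n ≥ 1 × f ≈ₚ X ^ₚ n

  InLpow : Pol → Set (c ⊔ ℓ)
  InLpow f = X ∣ₚ f × X-1 ∣ₚ (f -1ₚ) × (∀ g → g ∣ₚ f → IsUnit g ⊎ X ∣ₚ g)

module Submission where

-- Irreducibility: a factorisation x = a·b makes a and b divisors of x, so by
-- x ∈ lpow(x) each is a unit or a multiple of x; two multiples of x have a
-- product with vanishing x-coefficient, which x does not.
--
-- Reducedness: it suffices that every r with r² = 0 vanishes (a nilpotent
-- has a square-zero power).  Fix such an r.
--   * If lpow(x) ⊆ pow(x): f = x·((1-r) + r·x) has (1-r) + r·x as a unit
--     (inverse (1+r) - r·x), so f ∣ x and f inherits the divisor condition of
--     x; also f - 1 = (x-1)(1 + r·x).  Hence f ∈ lpow(x) ⊆ pow(x), and comparing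
--     coefficients of f = xⁿ forces r = 0.
--   * If pow(x) ⊆ lpow(x): x² = (x - r)(x + r) ∈ lpow(x), so x - r is a unit
--     (impossible: its constant term -r is nilpotent) or a multiple of x,
--     whence r = 0.

open import Defs
open import Algebra.Bundles using (CommutativeRing)
open import Level using (_⊔_)
open import Data.Nat using (ℕ; zero; suc; s≤s; z≤n)
open import Data.List using ([]; _∷_)
open import Data.Product using (_×_; _,_; ∃; proj₂)
open import Data.Sum using (_⊎_; inj₁; inj₂)
open import Data.Empty using (⊥; ⊥-elim)
open import Function using (_∘_)
open import Relation.Nullary using (¬_)
open import Relation.Binary.Bundles using (Setoid)
import Relation.Binary.Reasoning.Setoid as SetoidReasoning
import Algebra.Properties.Ring as RingProperties
import Algebra.Solver.Ring.NaturalCoefficients.Default as SemiringSolver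

module SquareZero {c ℓ} (R : CommutativeRing c ℓ) where
  open CommutativeRing R
  open Poly R using (_^ᴿ_; Reduced)
  open RingProperties ring using (-‿distribˡ-*; -‿distribʳ-*; -‿involutive; -0#≈0#)
  open SemiringSolver commutativeSemiring using (solve; _:=_; _:+_; _:*_)
  open SetoidReasoning setoid

  square-zero-nonunit : ∀ {r w} → r * r ≈ 0# → r * w ≈ 1# → 1# ≈ 0#
  square-zero-nonunit {r} {w} r²≈0 rw≈1 = begin
    1#                 ≈⟨ *-identityʳ 1# ⟨
    1# * 1#            ≈⟨ *-cong rw≈1 rw≈1 ⟨
    (r * w) * (r * w)  ≈⟨ solve 2 (λ r w → (r :* w) :* (r :* w) := (r :* r) :* (w :* w)) refl r w ⟩
    (r * r) * (w * w)  ≈⟨ *-congʳ r²≈0 ⟩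
    0# * (w * w)       ≈⟨ zeroˡ _ ⟩
    0#                 ∎

  neg-square : ∀ r → - r * - r ≈ r * r
  neg-square r = begin
    - r * - r        ≈⟨ -‿distribˡ-* r (- r) ⟨
    - (r * - r)      ≈⟨ -‿cong (-‿distribʳ-* r r) ⟨
    - (- (r * r))    ≈⟨ -‿involutive (r * r) ⟩
    r * r            ∎

  -- For r² = 0, the polynomial (1 - r) + r·x is invertible with inverse
  -- (1 + r) - r·x; these are the three coefficients of the product.
  module _ {r} (r²≈0 : r * r ≈ 0#) where
    neg-times-self : - r * r ≈ 0#
    neg-times-self = trans (sym (-‿distribˡ-* r r)) (trans (-‿cong r²≈0) -0#≈0#)

    times-neg-self : r * - r ≈ 0#
    times-neg-self = trans (*-comm r (- r)) neg-times-self

    inverse-constant : (1# + - r) * (1# + r) ≈ 1#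
    inverse-constant = begin
      (1# + - r) * (1# + r)
        ≈⟨ solve 3 (λ o m r → (o :+ m) :* (o :+ r) := o :* o :+ (o :* r :+ m :* o) :+ m :* r) refl 1# (- r) r ⟩
      1# * 1# + (1# * r + - r * 1#) + - r * r
        ≈⟨ +-cong (+-cong (*-identityʳ 1#) (+-cong (*-identityˡ r) (*-identityʳ (- r)))) neg-times-self ⟩
      1# + (r + - r) + 0#
        ≈⟨ +-identityʳ _ ⟩
      1# + (r + - r)
        ≈⟨ +-congˡ (-‿inverseʳ r) ⟩
      1# + 0#
        ≈⟨ +-identityʳ 1# ⟩
      1#
        ∎

    inverse-linear : (1# + - r) * - r + r * (1# + r) ≈ 0#
    inverse-linear = begin
      (1# + - r) * - r + r * (1# + r)
        ≈⟨ solve 3 (λ o m r → (o :+ m) :* m :+ r :* (o :+ r) := (o :* m :+ r :* o) :+ (m :* m :+ r :* r)) refl 1# (- r) r ⟩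
      (1# * - r + r * 1#) + (- r * - r + r * r)
        ≈⟨ +-cong (+-cong (*-identityˡ (- r)) (*-identityʳ r)) (+-congʳ (neg-square r)) ⟩
      (- r + r) + (r * r + r * r)
        ≈⟨ +-cong (-‿inverseˡ r) (+-cong r²≈0 r²≈0) ⟩
      0# + (0# + 0#)
        ≈⟨ +-identityˡ _ ⟩
      0# + 0#
        ≈⟨ +-identityʳ 0# ⟩
      0#
        ∎

  -- A ring in which only 0 squares to 0 is reduced: if r^(n+2) = 0 then
  -- (r^(n+1))² = r^(n+2)·rⁿ = 0, so r^(n+1) = 0, and one descends to r = 0.
  reduced-if-square-zero-vanishes : (∀ r → r * r ≈ 0# → r ≈ 0#) → Reduced
  reduced-if-square-zero-vanishes vanish r zero    1≈0 = begin
    r       ≈⟨ *-identityʳ r ⟨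
    r * 1#  ≈⟨ *-congˡ 1≈0 ⟩
    r * 0#  ≈⟨ zeroʳ r ⟩
    0#      ∎
  reduced-if-square-zero-vanishes vanish r (suc n) = descend n
    where
    descend : ∀ n → r ^ᴿ suc n ≈ 0# → r ≈ 0#
    descend zero    r*1≈0  = trans (sym (*-identityʳ r)) r*1≈0
    descend (suc n) rⁿ⁺²≈0 = descend n (vanish (r ^ᴿ suc n) (begin
      (r * r ^ᴿ n) * (r * r ^ᴿ n)  ≈⟨ solve 2 (λ r p → (r :* p) :* (r :* p) := (r :* (r :* p)) :* p) refl r (r ^ᴿ n) ⟩
      r ^ᴿ suc (suc n) * r ^ᴿ n    ≈⟨ *-congʳ rⁿ⁺²≈0 ⟩
      0# * r ^ᴿ n                  ≈⟨ zeroˡ _ ⟩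
      0#                           ∎))

-- All identities are proved
-- coefficientwise; writing 0# ∷ p for x·p, the multiplication satisfies
-- (a ∷ p)·q = a·q + x·(p·q) by definition, which drives every induction.
module PolynomialArithmetic {c ℓ} (R : CommutativeRing c ℓ) where
  open CommutativeRing R
  open Poly R
  open SemiringSolver commutativeSemiring using (solve; _:=_; _:+_; _:*_)
  open SetoidReasoning setoid

  ≈ₚ-setoid : Setoid c ℓ
  ≈ₚ-setoid = record
    { Carrier       = Pol
    ; _≈_           = _≈ₚ_
    ; isEquivalence = record
      { refl  = λ _ → refl
      ; sym   = λ p≈q n → sym (p≈q n)
      ; trans = λ p≈q q≈s n → trans (p≈q n) (q≈s n)
      }
    }

  shift-cong : ∀ {p q} → p ≈ₚ q → 0# ∷ p ≈ₚ 0# ∷ q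
  shift-cong p≈q zero    = refl
  shift-cong p≈q (suc n) = p≈q n

  shift-zero : ∀ {p} → p ≈ₚ 0ₚ → 0# ∷ p ≈ₚ 0ₚ
  shift-zero p≈0 zero    = refl
  shift-zero p≈0 (suc n) = p≈0 n

  coeff-+ : ∀ p q n → coeff (p +ₚ q) n ≈ coeff p n + coeff q n
  coeff-+ []      q       n       = sym (+-identityˡ _)
  coeff-+ (a ∷ p) []      n       = sym (+-identityʳ _)
  coeff-+ (a ∷ p) (b ∷ q) zero    = refl
  coeff-+ (a ∷ p) (b ∷ q) (suc n) = coeff-+ p q n

  coeff-shift-+ : ∀ p q n → coeff (0# ∷ p +ₚ q) n ≈ coeff (0# ∷ p) n + coeff (0# ∷ q) n
  coeff-shift-+ p q zero    = sym (+-identityˡ _)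
  coeff-shift-+ p q (suc n) = coeff-+ p q n

  +ₚ-cong : ∀ {p p′ q q′} → p ≈ₚ p′ → q ≈ₚ q′ → p +ₚ q ≈ₚ p′ +ₚ q′
  +ₚ-cong {p} {p′} {q} {q′} p≈p′ q≈q′ n = begin
    coeff (p +ₚ q) n            ≈⟨ coeff-+ p q n ⟩
    coeff p n + coeff q n       ≈⟨ +-cong (p≈p′ n) (q≈q′ n) ⟩
    coeff p′ n + coeff q′ n     ≈⟨ coeff-+ p′ q′ n ⟨
    coeff (p′ +ₚ q′) n          ∎

  coeff-scale : ∀ a p n → coeff (scale a p) n ≈ a * coeff p n
  coeff-scale a []      n       = sym (zeroʳ a)
  coeff-scale a (b ∷ p) zero    = refl
  coeff-scale a (b ∷ p) (suc n) = coeff-scale a p n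

  coeff-shift-scale : ∀ a p n → coeff (0# ∷ scale a p) n ≈ a * coeff (0# ∷ p) n
  coeff-shift-scale a p zero    = sym (zeroʳ a)
  coeff-shift-scale a p (suc n) = coeff-scale a p n

  coeff-∷-*ₚ : ∀ a p q n → coeff ((a ∷ p) *ₚ q) n ≈ a * coeff q n + coeff (0# ∷ p *ₚ q) n
  coeff-∷-*ₚ a p q n = trans (coeff-+ (scale a q) (0# ∷ p *ₚ q) n) (+-congʳ (coeff-scale a q n))

  coeff₀-*ₚ : ∀ p q → coeff (p *ₚ q) 0 ≈ coeff p 0 * coeff q 0
  coeff₀-*ₚ []      q = sym (zeroˡ _)
  coeff₀-*ₚ (a ∷ p) q = trans (coeff-∷-*ₚ a p q 0) (+-identityʳ _)

  shift-*ₚ : ∀ p q → (0# ∷ p) *ₚ q ≈ₚ 0# ∷ p *ₚ q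
  shift-*ₚ p q n = begin
    coeff ((0# ∷ p) *ₚ q) n                 ≈⟨ coeff-∷-*ₚ 0# p q n ⟩
    0# * coeff q n + coeff (0# ∷ p *ₚ q) n  ≈⟨ +-congʳ (zeroˡ _) ⟩
    0# + coeff (0# ∷ p *ₚ q) n              ≈⟨ +-identityˡ _ ⟩
    coeff (0# ∷ p *ₚ q) n                   ∎

  *ₚ-identityˡ : ∀ p → 1ₚ *ₚ p ≈ₚ p
  *ₚ-identityˡ p n = begin
    coeff (1ₚ *ₚ p) n                ≈⟨ coeff-∷-*ₚ 1# [] p n ⟩
    1# * coeff p n + coeff (0# ∷ []) n  ≈⟨ +-cong (*-identityˡ _) (shift-zero (λ _ → refl) n) ⟩
    coeff p n + 0#                   ≈⟨ +-identityʳ _ ⟩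
    coeff p n                        ∎

  *ₚ-zeroˡ : ∀ p q → p ≈ₚ 0ₚ → p *ₚ q ≈ₚ 0ₚ
  *ₚ-zeroˡ []      q p≈0 n = refl
  *ₚ-zeroˡ (a ∷ p) q p≈0 n = begin
    coeff ((a ∷ p) *ₚ q) n                 ≈⟨ coeff-∷-*ₚ a p q n ⟩
    a * coeff q n + coeff (0# ∷ p *ₚ q) n  ≈⟨ +-cong (*-congʳ (p≈0 0)) (shift-zero (*ₚ-zeroˡ p q (p≈0 ∘ suc)) n) ⟩
    0# * coeff q n + 0#                    ≈⟨ +-identityʳ _ ⟩
    0# * coeff q n                         ≈⟨ zeroˡ _ ⟩
    0#                                     ∎

  *ₚ-zeroʳ : ∀ p → p *ₚ 0ₚ ≈ₚ 0ₚ
  *ₚ-zeroʳ []      n = refl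
  *ₚ-zeroʳ (a ∷ p) n = begin
    coeff ((a ∷ p) *ₚ []) n          ≈⟨ coeff-∷-*ₚ a p [] n ⟩
    a * 0# + coeff (0# ∷ p *ₚ []) n  ≈⟨ +-cong (zeroʳ a) (shift-zero (*ₚ-zeroʳ p) n) ⟩
    0# + 0#                          ≈⟨ +-identityʳ 0# ⟩
    0#                               ∎

  *ₚ-congˡ : ∀ p p′ q → p ≈ₚ p′ → p *ₚ q ≈ₚ p′ *ₚ q
  *ₚ-congˡ []      p′        q p≈p′ n = sym (*ₚ-zeroˡ p′ q (λ m → sym (p≈p′ m)) n)
  *ₚ-congˡ (a ∷ p) []        q p≈p′ n = *ₚ-zeroˡ (a ∷ p) q p≈p′ n
  *ₚ-congˡ (a ∷ p) (a′ ∷ p′) q p≈p′ n = begin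
    coeff ((a ∷ p) *ₚ q) n                    ≈⟨ coeff-∷-*ₚ a p q n ⟩
    a * coeff q n + coeff (0# ∷ p *ₚ q) n     ≈⟨ +-cong (*-congʳ (p≈p′ 0)) (shift-cong (*ₚ-congˡ p p′ q (p≈p′ ∘ suc)) n) ⟩
    a′ * coeff q n + coeff (0# ∷ p′ *ₚ q) n   ≈⟨ coeff-∷-*ₚ a′ p′ q n ⟨
    coeff ((a′ ∷ p′) *ₚ q) n                  ∎

  *ₚ-distribʳ : ∀ p q s → (p +ₚ q) *ₚ s ≈ₚ p *ₚ s +ₚ q *ₚ s
  *ₚ-distribʳ []      q       s n = refl
  *ₚ-distribʳ (a ∷ p) []      s n = sym (trans (coeff-+ ((a ∷ p) *ₚ s) [] n) (+-identityʳ _))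
  *ₚ-distribʳ (a ∷ p) (b ∷ q) s n = begin
    coeff (((a + b) ∷ p +ₚ q) *ₚ s) n
      ≈⟨ coeff-∷-*ₚ (a + b) (p +ₚ q) s n ⟩
    (a + b) * sₙ + coeff (0# ∷ (p +ₚ q) *ₚ s) n
      ≈⟨ +-congˡ (shift-cong (*ₚ-distribʳ p q s) n) ⟩
    (a + b) * sₙ + coeff (0# ∷ p *ₚ s +ₚ q *ₚ s) n
      ≈⟨ +-congˡ (coeff-shift-+ (p *ₚ s) (q *ₚ s) n) ⟩
    (a + b) * sₙ + (coeff (0# ∷ p *ₚ s) n + coeff (0# ∷ q *ₚ s) n)
      ≈⟨ solve 5 (λ a b S P Q → (a :+ b) :* S :+ (P :+ Q) := (a :* S :+ P) :+ (b :* S :+ Q))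
           refl a b sₙ (coeff (0# ∷ p *ₚ s) n) (coeff (0# ∷ q *ₚ s) n) ⟩
    (a * sₙ + coeff (0# ∷ p *ₚ s) n) + (b * sₙ + coeff (0# ∷ q *ₚ s) n)
      ≈⟨ +-cong (coeff-∷-*ₚ a p s n) (coeff-∷-*ₚ b q s n) ⟨
    coeff ((a ∷ p) *ₚ s) n + coeff ((b ∷ q) *ₚ s) n
      ≈⟨ coeff-+ ((a ∷ p) *ₚ s) ((b ∷ q) *ₚ s) n ⟨
    coeff ((a ∷ p) *ₚ s +ₚ (b ∷ q) *ₚ s) n
      ∎
    where sₙ = coeff s n

  scale-*ₚ : ∀ a q s → scale a q *ₚ s ≈ₚ scale a (q *ₚ s)
  scale-*ₚ a []      s n = refl
  scale-*ₚ a (b ∷ q) s n = begin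
    coeff ((a * b ∷ scale a q) *ₚ s) n
      ≈⟨ coeff-∷-*ₚ (a * b) (scale a q) s n ⟩
    a * b * sₙ + coeff (0# ∷ scale a q *ₚ s) n
      ≈⟨ +-congˡ (shift-cong (scale-*ₚ a q s) n) ⟩
    a * b * sₙ + coeff (0# ∷ scale a (q *ₚ s)) n
      ≈⟨ +-congˡ (coeff-shift-scale a (q *ₚ s) n) ⟩
    a * b * sₙ + a * coeff (0# ∷ q *ₚ s) n
      ≈⟨ solve 4 (λ a b S P → a :* b :* S :+ a :* P := a :* (b :* S :+ P)) refl a b sₙ (coeff (0# ∷ q *ₚ s) n) ⟩
    a * (b * sₙ + coeff (0# ∷ q *ₚ s) n)
      ≈⟨ *-congˡ (coeff-∷-*ₚ b q s n) ⟨
    a * coeff ((b ∷ q) *ₚ s) n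
      ≈⟨ coeff-scale a ((b ∷ q) *ₚ s) n ⟨
    coeff (scale a ((b ∷ q) *ₚ s)) n
      ∎
    where sₙ = coeff s n

  *ₚ-assoc : ∀ p q s → (p *ₚ q) *ₚ s ≈ₚ p *ₚ (q *ₚ s)
  *ₚ-assoc []      q s n = refl
  *ₚ-assoc (a ∷ p) q s n = begin
    coeff ((scale a q +ₚ (0# ∷ p *ₚ q)) *ₚ s) n
      ≈⟨ *ₚ-distribʳ (scale a q) (0# ∷ p *ₚ q) s n ⟩
    coeff (scale a q *ₚ s +ₚ (0# ∷ p *ₚ q) *ₚ s) n
      ≈⟨ coeff-+ (scale a q *ₚ s) ((0# ∷ p *ₚ q) *ₚ s) n ⟩
    coeff (scale a q *ₚ s) n + coeff ((0# ∷ p *ₚ q) *ₚ s) n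
      ≈⟨ +-cong (scale-*ₚ a q s n) (shift-*ₚ (p *ₚ q) s n) ⟩
    coeff (scale a (q *ₚ s)) n + coeff (0# ∷ (p *ₚ q) *ₚ s) n
      ≈⟨ +-cong (coeff-scale a (q *ₚ s) n) (shift-cong (*ₚ-assoc p q s) n) ⟩
    a * coeff (q *ₚ s) n + coeff (0# ∷ p *ₚ (q *ₚ s)) n
      ≈⟨ coeff-∷-*ₚ a p (q *ₚ s) n ⟨
    coeff ((a ∷ p) *ₚ (q *ₚ s)) n
      ∎

  *ₚ-∷ʳ : ∀ p b q → p *ₚ (b ∷ q) ≈ₚ scale b p +ₚ (0# ∷ p *ₚ q)
  *ₚ-∷ʳ []      b q n       = sym (shift-zero (λ _ → refl) n)
  *ₚ-∷ʳ (a ∷ p) b q zero    = +-congʳ (*-comm a b)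
  *ₚ-∷ʳ (a ∷ p) b q (suc n) = begin
    coeff ((a ∷ p) *ₚ (b ∷ q)) (suc n)
      ≈⟨ coeff-∷-*ₚ a p (b ∷ q) (suc n) ⟩
    a * qₙ + coeff (p *ₚ (b ∷ q)) n
      ≈⟨ +-congˡ (*ₚ-∷ʳ p b q n) ⟩
    a * qₙ + coeff (scale b p +ₚ (0# ∷ p *ₚ q)) n
      ≈⟨ +-congˡ (coeff-+ (scale b p) (0# ∷ p *ₚ q) n) ⟩
    a * qₙ + (coeff (scale b p) n + coeff (0# ∷ p *ₚ q) n)
      ≈⟨ +-congˡ (+-congʳ (coeff-scale b p n)) ⟩
    a * qₙ + (b * coeff p n + coeff (0# ∷ p *ₚ q) n)
      ≈⟨ solve 3 (λ A B S → A :+ (B :+ S) := B :+ (A :+ S)) refl (a * qₙ) (b * coeff p n) (coeff (0# ∷ p *ₚ q) n) ⟩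
    b * coeff p n + (a * qₙ + coeff (0# ∷ p *ₚ q) n)
      ≈⟨ +-cong (coeff-scale b p n) (coeff-∷-*ₚ a p q n) ⟨
    coeff (scale b p) n + coeff ((a ∷ p) *ₚ q) n
      ≈⟨ coeff-+ (scale b p) ((a ∷ p) *ₚ q) n ⟨
    coeff (scale b p +ₚ (a ∷ p) *ₚ q) n
      ∎
    where qₙ = coeff q n

  *ₚ-comm : ∀ p q → p *ₚ q ≈ₚ q *ₚ p
  *ₚ-comm p []      = *ₚ-zeroʳ p
  *ₚ-comm p (b ∷ q) n =
    trans (*ₚ-∷ʳ p b q n) (+ₚ-cong {scale b p} {scale b p} (λ _ → refl) (shift-cong (*ₚ-comm p q)) n)

module Divisibility {c ℓ} (R : CommutativeRing c ℓ) where
  open CommutativeRing R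
  open Poly R
  open PolynomialArithmetic R
  open SetoidReasoning ≈ₚ-setoid

  X-*ₚ : ∀ p → X *ₚ p ≈ₚ 0# ∷ p
  X-*ₚ p = begin
    X *ₚ p            ≈⟨ shift-*ₚ 1ₚ p ⟩
    0# ∷ 1ₚ *ₚ p      ≈⟨ shift-cong (*ₚ-identityˡ p) ⟩
    0# ∷ p            ∎

  ∣ₚ-trans : ∀ {f g h} → f ∣ₚ g → g ∣ₚ h → f ∣ₚ h
  ∣ₚ-trans {f} {g} {h} (u , g≈fu) (v , h≈gv) = u *ₚ v , (begin
    h                 ≈⟨ h≈gv ⟩
    g *ₚ v            ≈⟨ *ₚ-congˡ g (f *ₚ u) v g≈fu ⟩
    (f *ₚ u) *ₚ v     ≈⟨ *ₚ-assoc f u v ⟩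
    f *ₚ (u *ₚ v)     ∎)

  shift-unit-∣ₚ-X : ∀ u → IsUnit u → (0# ∷ u) ∣ₚ X
  shift-unit-∣ₚ-X u (v , uv≈1) = v , (begin
    X                 ≈⟨ shift-cong uv≈1 ⟨
    0# ∷ u *ₚ v       ≈⟨ shift-*ₚ u v ⟨
    (0# ∷ u) *ₚ v     ∎)

  X-∣ₚ⇒coeff₀≈0 : ∀ g → X ∣ₚ g → coeff g 0 ≈ 0#
  X-∣ₚ⇒coeff₀≈0 g (h , g≈Xh) = trans (g≈Xh 0) (X-*ₚ h 0)

  unit⇒coeff₀-unit : ∀ u → IsUnit u → ∃ λ w → coeff u 0 * w ≈ 1#
  unit⇒coeff₀-unit u (v , uv≈1) = coeff v 0 , trans (sym (coeff₀-*ₚ u v)) (uv≈1 0)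

  coeff₁-*ₚ≈0 : ∀ p q → coeff p 0 ≈ 0# → coeff q 0 ≈ 0# → coeff (p *ₚ q) 1 ≈ 0#
  coeff₁-*ₚ≈0 []      q p₀≈0 q₀≈0 = refl
  coeff₁-*ₚ≈0 (a ∷ p) q a≈0  q₀≈0 = trans (coeff-∷-*ₚ a p q 1) (trans
    (+-cong (trans (*-congʳ a≈0) (zeroˡ _)) (trans (coeff₀-*ₚ p q) (trans (*-congˡ q₀≈0) (zeroʳ _))))
    (+-identityʳ 0#))

  DivisorsUnitOrXMultiple : Pol → Set (c ⊔ ℓ)
  DivisorsUnitOrXMultiple f = ∀ g → g ∣ₚ f → IsUnit g ⊎ X ∣ₚ g

  DivisorsUnitOrXMultiple-∣ₚ : ∀ {f g} → f ∣ₚ g → DivisorsUnitOrXMultiple g → DivisorsUnitOrXMultiple f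
  DivisorsUnitOrXMultiple-∣ₚ {f} {g} f∣g condition h h∣f = condition h (∣ₚ-trans {h} {f} {g} h∣f f∣g)

  linear-*ₚ : ∀ a₀ a₁ b₀ b₁ →
    (a₀ ∷ a₁ ∷ []) *ₚ (b₀ ∷ b₁ ∷ []) ≈ₚ a₀ * b₀ ∷ a₀ * b₁ + a₁ * b₀ ∷ a₁ * b₁ ∷ []
  linear-*ₚ a₀ a₁ b₀ b₁ zero                = +-identityʳ _
  linear-*ₚ a₀ a₁ b₀ b₁ (suc zero)          = +-congˡ (+-identityʳ _)
  linear-*ₚ a₀ a₁ b₀ b₁ (suc (suc n))       = refl

  quadratic-≈ₚ : ∀ {a₀ a₁ a₂ b₀ b₁ b₂} → a₀ ≈ b₀ → a₁ ≈ b₁ → a₂ ≈ b₂ →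
    a₀ ∷ a₁ ∷ a₂ ∷ [] ≈ₚ b₀ ∷ b₁ ∷ b₂ ∷ []
  quadratic-≈ₚ e₀ e₁ e₂ zero                = e₀
  quadratic-≈ₚ e₀ e₁ e₂ (suc zero)          = e₁
  quadratic-≈ₚ e₀ e₁ e₂ (suc (suc zero))    = e₂
  quadratic-≈ₚ e₀ e₁ e₂ (suc (suc (suc n))) = refl

module LpowOfX {c ℓ} (R : CommutativeRing c ℓ) where
  open CommutativeRing R
  open Poly R
  open PolynomialArithmetic R
  open Divisibility R
  open SquareZero R
  open RingProperties ring using (-1*x≈-x; -‿injective; -0#≈0#; x∙y⁻¹≈ε⇒x≈y)
  open SetoidReasoning ≈ₚ-setoid

  X-irreducible : ¬ (1# ≈ 0#) → InLpow X → Irreducible X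
  X-irreducible nontrivial (_ , _ , divisors) = X≉0 , X-nonunit , no-proper-factorisation
    where
    X≉0 : ¬ (X ≈ₚ 0ₚ)
    X≉0 X≈0 = nontrivial (X≈0 1)

    X-nonunit : ¬ IsUnit X
    X-nonunit X-unit = nontrivial (square-zero-nonunit (zeroˡ 0#) (proj₂ (unit⇒coeff₀-unit X X-unit)))

    -- two multiples of x multiply to something without linear term
    not-both-multiples : ∀ a b → X ≈ₚ a *ₚ b → ¬ IsUnit a → ¬ IsUnit b →
      IsUnit a ⊎ X ∣ₚ a → IsUnit b ⊎ X ∣ₚ b → ⊥
    not-both-multiples a b _    a-nonunit _         (inj₁ a-unit) _             = a-nonunit a-unit
    not-both-multiples a b _    _         b-nonunit _             (inj₁ b-unit) = b-nonunit b-unit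
    not-both-multiples a b X≈ab _         _         (inj₂ X∣a)    (inj₂ X∣b)    = nontrivial
      (trans (X≈ab 1) (coeff₁-*ₚ≈0 a b (X-∣ₚ⇒coeff₀≈0 a X∣a) (X-∣ₚ⇒coeff₀≈0 b X∣b)))

    no-proper-factorisation : ¬ (∃ λ a → ∃ λ b → X ≈ₚ a *ₚ b × ¬ IsUnit a × ¬ IsUnit b)
    no-proper-factorisation (a , b , X≈ab , a-nonunit , b-nonunit) =
      not-both-multiples a b X≈ab a-nonunit b-nonunit
        (divisors a (b , X≈ab)) (divisors b (a , λ n → trans (X≈ab n) (*ₚ-comm a b n)))

  module _ {r} (r²≈0 : r * r ≈ 0#) where
    private
      u : Pol
      u = 1# + - r ∷ r ∷ []

    f : Pol
    f = 0# ∷ u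

    u-unit : IsUnit u
    u-unit = 1# + r ∷ - r ∷ [] , (begin
      u *ₚ (1# + r ∷ - r ∷ [])
        ≈⟨ linear-*ₚ (1# + - r) r (1# + r) (- r) ⟩
      (1# + - r) * (1# + r) ∷ (1# + - r) * - r + r * (1# + r) ∷ r * - r ∷ []
        ≈⟨ quadratic-≈ₚ (inverse-constant r²≈0) (inverse-linear r²≈0) (times-neg-self r²≈0) ⟩
      1# ∷ 0# ∷ 0# ∷ []
        ≈⟨ (λ { zero → refl ; (suc zero) → refl ; (suc (suc zero)) → refl ; (suc (suc (suc n))) → refl }) ⟩ -- trailing zeros
      1ₚ
        ∎)

    X-1-∣ₚ-f-1 : X-1 ∣ₚ (f -1ₚ)
    X-1-∣ₚ-f-1 = 1# ∷ r ∷ [] , (begin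
      f -1ₚ
        ≈⟨ quadratic-≈ₚ (trans (+-identityˡ (- 1#)) (sym (*-identityʳ (- 1#))))
                        (trans (+-comm 1# (- r)) (+-cong (sym (-1*x≈-x r)) (sym (*-identityʳ 1#))))
                        (sym (*-identityˡ r)) ⟩
      - 1# * 1# ∷ - 1# * r + 1# * 1# ∷ 1# * r ∷ []
        ≈⟨ linear-*ₚ (- 1#) 1# 1# r ⟨
      X-1 *ₚ (1# ∷ r ∷ [])
        ∎)

    -- f is x times a unit, so it divides x and inherits the divisor condition of x.
    f-∈-lpow : InLpow X → InLpow f
    f-∈-lpow (_ , _ , divisors) =
      (u , λ n → sym (X-*ₚ u n)) , X-1-∣ₚ-f-1 , DivisorsUnitOrXMultiple-∣ₚ {f} {X} (shift-unit-∣ₚ-X u u-unit) divisors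

    -- comparing coefficients of f = xⁿ forces r = 0 (n = 1) or 1 = 0 (n ≥ 2)
    f-∈-pow⇒r≈0 : ¬ (1# ≈ 0#) → InPow f → r ≈ 0#
    f-∈-pow⇒r≈0 nontrivial (suc zero , _ , f≈X) = trans (f≈X 2) (X-*ₚ 1ₚ 2)
    f-∈-pow⇒r≈0 nontrivial (suc (suc j) , _ , f≈Xⁿ) =
      ⊥-elim (nontrivial (square-zero-nonunit r²≈0 (trans (*-identityʳ r) (sym 1≈r))))
      where
      1-r≈0 : 1# + - r ≈ 0#
      1-r≈0 = trans (f≈Xⁿ 1) (trans (X-*ₚ (X ^ₚ suc j) 1) (X-∣ₚ⇒coeff₀≈0 (X ^ₚ suc j) (X ^ₚ j , λ _ → refl)))

      1≈r : 1# ≈ r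
      1≈r = x∙y⁻¹≈ε⇒x≈y 1# r 1-r≈0

  square-zero-vanishes-if-lpow⊆pow : ¬ (1# ≈ 0#) → InLpow X → (∀ f → InLpow f → InPow f) →
    ∀ r → r * r ≈ 0# → r ≈ 0#
  square-zero-vanishes-if-lpow⊆pow nontrivial X-∈-lpow lpow⊆pow r r²≈0 =
    f-∈-pow⇒r≈0 r²≈0 nontrivial (lpow⊆pow (f r²≈0) (f-∈-lpow r²≈0 X-∈-lpow))

  X²-factorisation : ∀ {r} → r * r ≈ 0# → X ^ₚ 2 ≈ₚ (- r ∷ 1# ∷ []) *ₚ (r ∷ 1# ∷ [])
  X²-factorisation {r} r²≈0 = begin
    X *ₚ (X *ₚ 1ₚ)
      ≈⟨ X-*ₚ (X *ₚ 1ₚ) ⟩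
    0# ∷ X *ₚ 1ₚ
      ≈⟨ shift-cong (X-*ₚ 1ₚ) ⟩
    0# ∷ 0# ∷ 1# ∷ []
      ≈⟨ quadratic-≈ₚ (sym (neg-times-self r²≈0))
                      (sym (trans (+-cong (*-identityʳ (- r)) (*-identityˡ r)) (-‿inverseˡ r)))
                      (sym (*-identityʳ 1#)) ⟩
    - r * r ∷ - r * 1# + 1# * r ∷ 1# * 1# ∷ []
      ≈⟨ linear-*ₚ (- r) 1# r 1# ⟨
    (- r ∷ 1# ∷ []) *ₚ (r ∷ 1# ∷ [])
      ∎

  square-zero-vanishes-if-pow⊆lpow : ¬ (1# ≈ 0#) → (∀ f → InPow f → InLpow f) →
    ∀ r → r * r ≈ 0# → r ≈ 0#
  square-zero-vanishes-if-pow⊆lpow nontrivial pow⊆lpow r r²≈0 =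
    unit-or-multiple (divisors-X² (- r ∷ 1# ∷ []) (r ∷ 1# ∷ [] , X²-factorisation r²≈0))
    where
    divisors-X² : DivisorsUnitOrXMultiple (X ^ₚ 2)
    divisors-X² = proj₂ (proj₂ (pow⊆lpow (X ^ₚ 2) (2 , s≤s z≤n , λ _ → refl)))

    unit-or-multiple : IsUnit (- r ∷ 1# ∷ []) ⊎ X ∣ₚ (- r ∷ 1# ∷ []) → r ≈ 0#
    unit-or-multiple (inj₁ X-r-unit) = ⊥-elim (nontrivial (square-zero-nonunit
      (trans (neg-square r) r²≈0) (proj₂ (unit⇒coeff₀-unit (- r ∷ 1# ∷ []) X-r-unit))))
    unit-or-multiple (inj₂ X∣X-r) =
      -‿injective (trans (X-∣ₚ⇒coeff₀≈0 (- r ∷ 1# ∷ []) X∣X-r) (sym -0#≈0#))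

proposition2p5 : ∀ {c ℓ} (R : CommutativeRing c ℓ) →
    ¬ (CommutativeRing._≈_ R (CommutativeRing.1# R) (CommutativeRing.0# R)) →
    (Poly.InLpow R (Poly.X R) → Poly.Irreducible R (Poly.X R)) ×
    (Poly.InLpow R (Poly.X R) →
      ((∀ f → Poly.InLpow R f → Poly.InPow R f) ⊎ (∀ f → Poly.InPow R f → Poly.InLpow R f)) →
      Poly.Reduced R)
proposition2p5 R nontrivial = X-irreducible nontrivial , λ
  { X-∈-lpow (inj₁ lpow⊆pow) → reduced-if-square-zero-vanishes
      (square-zero-vanishes-if-lpow⊆pow nontrivial X-∈-lpow lpow⊆pow)
  ; X-∈-lpow (inj₂ pow⊆lpow) → reduced-if-square-zero-vanishes
      (square-zero-vanishes-if-pow⊆lpow nontrivial pow⊆lpow)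
  }
  where
  open LpowOfX R
  open SquareZero R using (reduced-if-square-zero-vanishes)
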